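{- Let $\Sigma$ be an alphabet of size $\sigma$, $k\ge1$, and let $W=(p_1,\ldots,p_n)$ be a realizable walk in the directed Parikh-de-Bruijn grid $G(k,\sigma)$ which uses no bows, i.e. $p_i\neq p_{i+1}$ for all $i=1,\ldots,n-1$. Then: (1) if $w=w_1\ldots w_{n+k-1}$ is a string spelled by $W$, then $w_i\neq w_{i+k}$ for every $i=1,\ldots,n-1$; (2) if $p_i=k\cdot e_j$ for some $j$ and some $i$ with $i+k\le n$, then $q=p_{i+k}$ satisfies $q_j=0$.
   Context: Let $\Sigma=\{a_1<\dots<a_\sigma\}$. For a string $u$ over $\Sigma$, $\mathbf{pv}(u)\in\mathbb{N}^\sigma$ has $i$-th entry the number of occurrences of $a_i$ in $u$; the order of a Parikh vector is the sum of its entries; $\mathrm{PV}(k,\sigma)$ is the set of Parikh vectors of order $k$; $e_i=\mathbf{pv}(a_i)$. Two order-$k$ Parikh vectors $p,q$ are neighbors if $q=p-e_i+e_j$ for some $i\ne j$. The directed Parikh-de-Bruijn grid $G(k,\sigma)$ has vertex set $\mathrm{PV}(k,\sigma)$; for neighbors $p=q-e_i+e_j$ it has an edge $(p,q)$ labeled $(a_i,a_j)$ and an edge $(q,p)$ labeled $(a_j,a_i)$; for every vertex $p$ and every $i$ with $p_i\ne0$ it has a loop (bow) $(p,p)$ labeled $(a_i,a_i)$. A walk is identified with its vertex sequence. A walk $(p_1,\ldots,p_m)$ spells $w=w_1\ldots w_n$ if $m=n-k+1$ and $\mathbf{pv}(w_i\ldots w_{i+k-1})=p_i$ for all $i$;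 a walk is realizable if it spells some string. -}

module Defs where

open import Data.Nat using (ℕ; zero; suc; _+_; _∸_; _<_; _≤_)
open import Data.Nat.Properties using (≤-refl)
open import Data.Fin using (Fin; toℕ; fromℕ<)
open import Data.Vec using (Vec; lookup; tabulate; updateAt; replicate; _∷_; [])
open import Data.Vec.Functional as VF using ()
open import Data.List using (List; length; []; _∷_; drop; take)
open import Data.List.Relation.Unary.AllPairs using ()
open import Data.Product using (Σ; ∃; ∃-syntax; _×_; _,_)
open import Data.Sum using (_⊎_)
open import Relation.Binary.PropositionalEquality using (_≡_; _≢_)
open import Data.Fin using (_≟_)
open import Relation.Nullary using (does)
open import Data.Bool using (if_then_else_)

-- The alphabet Σ = {a_1 < ... < a_σ} is modelled by Fin σ (a_i ↦ the (i-1)-th element).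
-- Parikh vectors in ℕ^σ are modelled by Vec ℕ σ.
ParikhVec : ℕ → Set
ParikhVec σ = Vec ℕ σ

vsum : ∀ {σ} → Vec ℕ σ → ℕ
vsum [] = 0
vsum (x ∷ xs) = x + vsum xs

order : ∀ {σ} → ParikhVec σ → ℕ
order = vsum

count : ∀ {σ} → Fin σ → List (Fin σ) → ℕ
count a [] = 0
count a (x ∷ xs) = if does (a ≟ x) then suc (count a xs) else count a xs

pv : ∀ {σ} → List (Fin σ) → ParikhVec σ
pv u = tabulate (λ i → count i u)

e : ∀ {σ} → Fin σ → ParikhVec σ
e i = pv (i ∷ [])

_·_ : ∀ {σ} → ℕ → ParikhVec σ → ParikhVec σ
k · p = Data.Vec.map (λ x → k Data.Nat.* x) p

InPV : ∀ {σ} → ℕ → ParikhVec σ → Set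
InPV k p = order p ≡ k

-- Edges of the directed Parikh-de-Bruijn grid G(k,σ) (on vertices of PV(k,σ)):
-- an edge (p,q) labeled (a_i,a_j), i ≠ j, exists iff p = q - e_i + e_j,
-- i.e. p + e_i = q + e_j (subtraction-free form, q_i ≥ 1 is then forced);
-- a bow (p,p) labeled (a_i,a_i) exists iff p_i ≠ 0.
_+ᵛ_ : ∀ {σ} → ParikhVec σ → ParikhVec σ → ParikhVec σ
p +ᵛ q = Data.Vec.zipWith _+_ p q

EdgeLabeled : ∀ {σ} → ParikhVec σ → ParikhVec σ → Fin σ → Fin σ → Set
EdgeLabeled p q i j = (i ≢ j × p +ᵛ e i ≡ q +ᵛ e j) ⊎ (i ≡ j × p ≡ q × lookup p i ≢ 0)

Edge : ∀ {σ} → ParikhVec σ → ParikhVec σ → Set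
Edge {σ} p q = Σ (Fin σ) λ i → Σ (Fin σ) λ j → EdgeLabeled p q i j

-- A walk in G(k,σ), identified with its vertex sequence (p_1,...,p_n), here
-- given as a function from positions 0..n-1 (0-indexed).
IsWalk : ∀ {σ} (k n : ℕ) → (ℕ → ParikhVec σ) → Set
IsWalk k n P = (∀ i → i < n → InPV k (P i)) × (∀ i → suc i < n → Edge (P i) (P (suc i)))

-- The walk (P 0, …, P (n-1)) spells w (0-indexed: w = w_0 … w_{length w - 1})
-- iff n = |w| - k + 1 and pv(w_i … w_{i+k-1}) = P i for all i < n.
Spells : ∀ {σ} (k n : ℕ) → (ℕ → ParikhVec σ) → List (Fin σ) → Set
Spells k n P w = (n + k ∸ 1 ≡ length w) × (∀ i → i < n → pv (take k (drop i w)) ≡ P i)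

Realizable : ∀ {σ} (k n : ℕ) → (ℕ → ParikhVec σ) → Set
Realizable {σ} k n P = ∃[ w ] Spells {σ} k n P w

-- The i-th letter of w (0-indexed), as a list lookup returning the suffix head.
at : ∀ {σ} → List (Fin σ) → ℕ → List (Fin σ)
at w i = take 1 (drop i w)

-- If the letters at positions i and i + k of w coincide, the window of length k
-- starting at i + 1 is obtained from the one starting at i by removing one copy of
-- that letter and adding it back, so the two windows have the same Parikh vector:
-- the walk would take a bow.
-- If p_i = k·e_j, the whole window at i consists of the letter a_j; an occurrence
-- of a_j at position i + k + t (t < k) would then repeat the letter at i + t.
module Submission where

open import Defs
open import Data.Nat using (ℕ; zero; suc; _+_; _*_; _<_; _≤_; z≤n; s≤s)
open import Data.Nat.Properties
  using (+-comm; +-cancelˡ-≡; *-identityʳ; suc-injective; ≤-trans; <-trans; <⇒≱; n<1+n;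
         m≤n⇒m≤1+n; m≤m+n; +-monoʳ-<; ≤-<-trans; +-commutativeSemigroup)
open import Algebra.Properties.CommutativeSemigroup +-commutativeSemigroup using (xy∙z≈xz∙y)
open import Data.Fin using (Fin; _≟_)
open import Data.List using (List; []; _∷_; _++_; take; drop)
open import Data.List.Properties using (drop-drop)
open import Data.Vec using (lookup)
open import Data.Vec.Properties using (lookup∘tabulate; lookup-map; tabulate-cong)
open import Data.Product using (_×_; _,_)
open import Relation.Nullary using (yes; no; contradiction)
open import Relation.Nullary.Decidable using (dec-true)
open import Relation.Binary.PropositionalEquality
open ≡-Reasoning

private
  variable
    σ : ℕ

count-++ : (a : Fin σ) (xs ys : List (Fin σ)) → count a (xs ++ ys) ≡ count a xs + count a ys
count-++ a []       ys = refl
count-++ a (x ∷ xs) ys with a ≟ x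
... | yes _ = cong suc (count-++ a xs ys)
... | no  _ = count-++ a xs ys

count-self : (a : Fin σ) → count a (a ∷ []) ≡ 1
count-self a rewrite dec-true (a ≟ a) refl = refl

count-take≤ : (a : Fin σ) (k : ℕ) (u : List (Fin σ)) → count a (take k u) ≤ k
count-take≤ a zero    u       = z≤n
count-take≤ a (suc k) []      = z≤n
count-take≤ a (suc k) (x ∷ u) with a ≟ x
... | yes _ = s≤s (count-take≤ a k u)
... | no  _ = m≤n⇒m≤1+n (count-take≤ a k u)

count-take≡⇒at≡ : (a : Fin σ) (k : ℕ) (u : List (Fin σ)) →
                  count a (take k u) ≡ k → ∀ t → t < k → at u t ≡ a ∷ []
count-take≡⇒at≡ a (suc k) (x ∷ u) full t t<k with a ≟ x
count-take≡⇒at≡ a (suc k) (x ∷ u) full zero    _         | yes refl = refl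
count-take≡⇒at≡ a (suc k) (x ∷ u) full (suc t) (s≤s t<k) | yes _    =
  count-take≡⇒at≡ a k u (suc-injective full) t t<k
... | no _ = contradiction (subst (_≤ k) full (count-take≤ a k u)) (<⇒≱ (n<1+n k))

at≢⇒count-take≡0 : (a : Fin σ) (k : ℕ) (u : List (Fin σ)) →
                   (∀ t → t < k → at u t ≢ a ∷ []) → count a (take k u) ≡ 0
at≢⇒count-take≡0 a zero    u       _      = refl
at≢⇒count-take≡0 a (suc k) []      _      = refl
at≢⇒count-take≡0 a (suc k) (x ∷ u) absent with a ≟ x
... | yes refl = contradiction refl (absent 0 (s≤s z≤n))
... | no  _    = at≢⇒count-take≡0 a k u (λ t t<k → absent (suc t) (s≤s t<k))

lookup-pv : (u : List (Fin σ)) (a : Fin σ) → lookup (pv u) a ≡ count a u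
lookup-pv u a = lookup∘tabulate (λ b → count b u) a

lookup-·e : (k : ℕ) (j : Fin σ) → lookup (k · e j) j ≡ k
lookup-·e k j = begin
  lookup (k · e j) j     ≡⟨ lookup-map j (k *_) (e j) ⟩
  k * lookup (e j) j     ≡⟨ cong (k *_) (trans (lookup-pv (j ∷ []) j) (count-self j)) ⟩
  k * 1                  ≡⟨ *-identityʳ k ⟩
  k                      ∎

take-suc-++-at : (k : ℕ) (u : List (Fin σ)) → take (suc k) u ≡ take k u ++ at u k
take-suc-++-at zero    u       = refl
take-suc-++-at (suc k) []      = refl
take-suc-++-at (suc k) (x ∷ u) = cong (x ∷_) (take-suc-++-at k u)

take-suc-head : (k : ℕ) (u : List (Fin σ)) → take (suc k) u ≡ at u 0 ++ take k (drop 1 u)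
take-suc-head zero    []      = refl
take-suc-head (suc k) []      = refl
take-suc-head k       (x ∷ u) = refl

pv-window-slide : (k : ℕ) (u : List (Fin σ)) → at u 0 ≡ at u k →
                  pv (take k u) ≡ pv (take k (drop 1 u))
pv-window-slide k u ends≡ = tabulate-cong λ a → sym (+-cancelˡ-≡ (count a (at u k)) _ _ (begin
  count a (at u k) + count a (take k (drop 1 u))
    ≡⟨ cong (λ x → count a x + count a (take k (drop 1 u))) (sym ends≡) ⟩
  count a (at u 0) + count a (take k (drop 1 u))
    ≡⟨ sym (count-++ a (at u 0) _) ⟩
  count a (at u 0 ++ take k (drop 1 u))
    ≡⟨ cong (count a) (trans (sym (take-suc-head k u)) (take-suc-++-at k u)) ⟩
  count a (take k u ++ at u k)
    ≡⟨ count-++ a (take k u) (at u k) ⟩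
  count a (take k u) + count a (at u k)
    ≡⟨ +-comm (count a (take k u)) _ ⟩
  count a (at u k) + count a (take k u) ∎))

at-drop : (i t : ℕ) (w : List (Fin σ)) → at (drop i w) t ≡ at w (i + t)
at-drop i t w = cong (take 1) (drop-drop i t w)

pv-window-suc : (k i : ℕ) (w : List (Fin σ)) → at w i ≡ at w (i + k) →
                pv (take k (drop i w)) ≡ pv (take k (drop (suc i) w))
pv-window-suc k i w ends≡ = begin
  pv (take k (drop i w))
    ≡⟨ pv-window-slide k (drop i w) (trans ends≡ (sym (at-drop i k w))) ⟩
  pv (take k (drop 1 (drop i w)))
    ≡⟨ cong (λ m → pv (take k m)) (trans (drop-drop i 1 w) (cong (λ m → drop m w) (+-comm i 1))) ⟩
  pv (take k (drop (suc i) w)) ∎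

module _ {σ : ℕ} (k n : ℕ) (P : ℕ → ParikhVec σ) (noBows : ∀ i → suc i < n → P i ≢ P (suc i)) where

  spelled-letters-differ : ∀ (w : List (Fin σ)) → Spells k n P w →
                           ∀ i → suc i < n → at w i ≢ at w (i + k)
  spelled-letters-differ w (_ , windows) i si<n ends≡ = noBows i si<n (begin
    P i                             ≡⟨ sym (windows i (<-trans (n<1+n i) si<n)) ⟩
    pv (take k (drop i w))          ≡⟨ pv-window-suc k i w ends≡ ⟩
    pv (take k (drop (suc i) w))    ≡⟨ windows (suc i) si<n ⟩
    P (suc i)                       ∎)

  pure-window-cleared : ∀ (w : List (Fin σ)) → Spells k n P w →
                        ∀ i (j : Fin σ) → i + k < n → P i ≡ k · e j → lookup (P (i + k)) j ≡ 0
  pure-window-cleared w spells@(_ , windows) i j i+k<n Pi≡kej = begin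
    lookup (P (i + k)) j                      ≡⟨ cong (λ p → lookup p j) (sym (windows (i + k) i+k<n)) ⟩
    lookup (pv (take k (drop (i + k) w))) j   ≡⟨ lookup-pv (take k (drop (i + k) w)) j ⟩
    count j (take k (drop (i + k) w))         ≡⟨ at≢⇒count-take≡0 j k (drop (i + k) w) absent ⟩
    0                                         ∎
    where
    pure : count j (take k (drop i w)) ≡ k
    pure = begin
      count j (take k (drop i w))         ≡⟨ sym (lookup-pv (take k (drop i w)) j) ⟩
      lookup (pv (take k (drop i w))) j   ≡⟨ cong (λ p → lookup p j) (trans (windows i (≤-trans (s≤s (m≤m+n i k)) i+k<n)) Pi≡kej) ⟩
      lookup (k · e j) j                  ≡⟨ lookup-·e k j ⟩
      k                                   ∎

    absent : ∀ t → t < k → at (drop (i + k) w) t ≢ j ∷ []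
    absent t t<k at≡j = spelled-letters-differ w spells (i + t) si+t<n (begin
      at w (i + t)            ≡⟨ sym (at-drop i t w) ⟩
      at (drop i w) t         ≡⟨ count-take≡⇒at≡ j k (drop i w) pure t t<k ⟩
      j ∷ []                  ≡⟨ sym at≡j ⟩
      at (drop (i + k) w) t   ≡⟨ at-drop (i + k) t w ⟩
      at w (i + k + t)        ≡⟨ cong (at w) (xy∙z≈xz∙y i k t) ⟩
      at w (i + t + k)        ∎)
      where
      si+t<n : suc (i + t) < n
      si+t<n = ≤-<-trans (+-monoʳ-< i t<k) i+k<n

lemma2 : ∀ {σ} (k n : ℕ) (P : ℕ → ParikhVec σ) → 1 ≤ k → 1 ≤ n
    → IsWalk {σ} k n P → Realizable {σ} k n P
    → (∀ i → suc i < n → P i ≢ P (suc i))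
    → (∀ (w : List (Fin σ)) → Spells k n P w → ∀ i → suc i < n → at w i ≢ at w (i + k))
    × (∀ (i : ℕ) (j : Fin σ) → i + k < n → P i ≡ k · e j → lookup (P (i + k)) j ≡ 0)
lemma2 k n P _ _ _ (w , spells) noBows =
  spelled-letters-differ k n P noBows , pure-window-cleared k n P noBows w spells
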